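{- Every finite union-closed family $\mathcal{F}$ satisfying $\mathrm{T}_{\mathrm D}$ is independent.
   Context: $U(\mathcal{F})$ is the union of the members of $\mathcal{F}$; $\mathcal{F}_a=\{F\in\mathcal{F}:a\in F\}$, $\mathcal{F}_{\tilde a}=\{F\in\mathcal{F}:a\notin F\}$. $\mathcal{F}$ satisfies $\mathrm{T}_{\mathrm D}$ if for every $x\in U(\mathcal{F})$ there is $O\in\mathcal{F}$ with $x\notin O$ and $O\cup\{x\}\in\mathcal{F}$ (such $O$ is called $x$-problematic). $\mathcal{F}$ is independent if for every $a\in U(\mathcal{F})$ and every $S\subseteq U(\mathcal{F})\setminus\{a\}$ at least one holds: (i) there is $O\in\mathcal{F}_{\tilde a}$ with $O\cap S\neq\emptyset$; (ii) there is $O\in\mathcal{F}_a$ with $O\cap S=\emptyset$. -}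

module Defs where

open import Data.Nat using (ℕ)
open import Data.Fin using (Fin)
open import Data.Fin.Subset using (Subset; _∈_; _∉_; _⊆_; _∪_; _∩_; ⁅_⁆; ⋃; Nonempty; Empty)
open import Data.List using (List)
import Data.List.Membership.Propositional as L
open import Data.Product using (Σ; _×_)
open import Data.Sum using (_⊎_)

-- A family of sets over the finite ground set Fin n, given as a finite list
-- of subsets (duplicates are harmless: only membership matters).
Family : ℕ → Set
Family n = List (Subset n)

U : ∀ {n} → Family n → Subset n
U F = ⋃ F

UnionClosed : ∀ {n} → Family n → Set
UnionClosed F = ∀ {A B} → A L.∈ F → B L.∈ F → (A ∪ B) L.∈ F

Problematic : ∀ {n} → Family n → Fin n → Subset n → Set
Problematic F x O = O L.∈ F × x ∉ O × (O ∪ ⁅ x ⁆) L.∈ F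

TD : ∀ {n} → Family n → Set
TD F = ∀ x → x ∈ U F → Σ (Subset _) (λ O → Problematic F x O)

Independent : ∀ {n} → Family n → Set
Independent F =
  ∀ a → a ∈ U F → ∀ (S : Subset _) → S ⊆ U F → a ∉ S →
    Σ (Subset _) (λ O → O L.∈ F × a ∉ O × Nonempty (O ∩ S))
    ⊎ Σ (Subset _) (λ O → O L.∈ F × a ∈ O × Empty (O ∩ S))

-- Take an a-problematic set O. If O meets S it witnesses (i), since a ∉ O.
-- Otherwise O ∪ {a} witnesses (ii): it contains a, and it misses S because O
-- does and a ∉ S.
module Submission where

open import Defs
open import Data.Nat using (ℕ)
open import Data.Fin using (Fin)
open import Data.Fin.Subset using (Subset; _∈_; _∉_; _∩_; _∪_; ⁅_⁆; Nonempty; Empty)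
open import Data.Fin.Subset.Properties
  using (nonempty?; x∈p∩q⁻; x∈p∩q⁺; x∈p∪q⁻; x∈p∪q⁺; x∈⁅x⁆; x∈⁅y⁆⇒x≡y)
import Data.List.Membership.Propositional as L
open import Data.Product using (Σ; _×_; _,_; proj₂)
open import Data.Sum using (_⊎_; inj₁; inj₂)
open import Relation.Nullary using (yes; no)
open import Relation.Binary.PropositionalEquality using (subst)

IndependentAt : ∀ {n} → Family n → Fin n → Subset n → Set
IndependentAt F a S =
  Σ (Subset _) (λ O → O L.∈ F × a ∉ O × Nonempty (O ∩ S))
  ⊎ Σ (Subset _) (λ O → O L.∈ F × a ∈ O × Empty (O ∩ S))

∪-⁅⁆-disjoint : ∀ {n} {O S : Subset n} {a : Fin n} →
                a ∉ S → Empty (O ∩ S) → Empty ((O ∪ ⁅ a ⁆) ∩ S)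
∪-⁅⁆-disjoint {O = O} {S} {a} a∉S O∩S-empty (x , x∈Oa∩S)
  with x∈p∩q⁻ (O ∪ ⁅ a ⁆) S x∈Oa∩S
... | x∈Oa , x∈S with x∈p∪q⁻ O ⁅ a ⁆ x∈Oa
...   | inj₁ x∈O = O∩S-empty (x , x∈p∩q⁺ (x∈O , x∈S))
...   | inj₂ x∈⁅a⁆ = a∉S (subst (_∈ S) (x∈⁅y⁆⇒x≡y a x∈⁅a⁆) x∈S)

problematic⇒independentAt : ∀ {n} {F : Family n} {a : Fin n} {O S : Subset n} →
                            Problematic F a O → a ∉ S → IndependentAt F a S
problematic⇒independentAt {a = a} {O} {S} (O∈F , a∉O , Oa∈F) a∉S
  with nonempty? (O ∩ S)
... | yes O∩S-nonempty = inj₁ (O , O∈F , a∉O , O∩S-nonempty)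
... | no O∩S-empty =
  inj₂ (O ∪ ⁅ a ⁆ , Oa∈F , x∈p∪q⁺ (inj₂ (x∈⁅x⁆ a)) , ∪-⁅⁆-disjoint a∉S O∩S-empty)

TD⇒Independent : ∀ {n} (F : Family n) → TD F → Independent F
TD⇒Independent F td a a∈U S _ a∉S =
  problematic⇒independentAt (proj₂ (td a a∈U)) a∉S

proposition3p4 : ∀ (n : ℕ) (F : Family n) → UnionClosed F → TD F → Independent F
proposition3p4 n F _ = TD⇒Independent F
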